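{- Let $\mathcal F$ be a filter on $\omega$. The following are equivalent: (1) $\mathcal F$ is completely meager, i.e. the filter generated by $\mathcal F\cup\{X\}$ is meager whenever $X\subseteq\omega$ and $\omega\setminus X\notin\mathcal F$. (2) For every sequence $\langle X_i: i\in\omega\rangle$ of finite subsets of $\omega$ with $\bigcup_i X_i\in\mathcal F^+$, there is a strictly increasing sequence $n_0<n_1<\cdots$ such that for every $Y\in\mathcal F$ and all but finitely many $k$, \[ Y\cap\bigcup_{i\in[n_k,n_{k+1})}X_i\neq\emptyset. \]
   Context: A filter on $\omega$ is a family of subsets of $\omega$ closed under finite intersections and supersets and containing all cofinite sets. $\mathcal F^+=\{X\subseteq\omega:\omega\setminus X\notin\mathcal F\}$. Subsets of $\omega$ are identified with their characteristic functions in $2^\omega$ with the product topology; "meager" refers to this topology. -}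

module Defs where

open import Level using (Level) renaming (suc to lsuc; zero to lzero)
open import Data.Nat using (ℕ; zero; suc; _≤_; _<_)
open import Data.Bool using (Bool; T)
open import Data.List using (List; []; _∷_; _++_)
open import Data.List.Membership.Propositional using (_∈_)
open import Data.Product using (Σ; _×_; ∃)
open import Data.Sum using (_⊎_)
open import Data.Unit using (⊤)
open import Relation.Nullary using (¬_)
open import Relation.Binary.PropositionalEquality using (_≡_)
open import Function.Bundles using (_⇔_)

Subset : Set₁
Subset = ℕ → Set

Family : Set₂
Family = Subset → Set₁

_⊆_ : Subset → Subset → Set
X ⊆ Y = ∀ n → X n → Y n

_∩_ : Subset → Subset → Subset
(X ∩ Y) n = X n × Y n

∁ : Subset → Subset
∁ X n = ¬ X n

Cofinite : Subset → Set
Cofinite X = Σ ℕ λ N → ∀ n → N ≤ n → X n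

record IsFilter (F : Family) : Set₂ where
  field
    superset     : ∀ X Y → F X → X ⊆ Y → F Y
    intersection : ∀ X Y → F X → F Y → F (X ∩ Y)
    cofinite     : ∀ X → Cofinite X → F X

_⁺ : Family → Subset → Set₁
(F ⁺) X = ¬ F (∁ X)

Adjoin : Family → Subset → Family
Adjoin F X Y = F Y ⊎ (Y ≡ X)

data Generated (A : Family) : Family where
  base         : ∀ {Y} → A Y → Generated A Y
  superset     : ∀ {Y Z} → Generated A Y → Y ⊆ Z → Generated A Z
  intersection : ∀ {Y Z} → Generated A Y → Generated A Z → Generated A (Y ∩ Z)
  cofinite     : ∀ {Y} → Cofinite Y → Generated A Y

-- Topology of 2^ω: basic open set [s] for a finite binary string s.
-- X ∈ [s]  iff  X agrees with s on the first (length s) coordinates.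
Extends : Subset → List Bool → Set
Extends X []      = ⊤
Extends X (b ∷ s) = (X zero ⇔ T b) × Extends (λ n → X (suc n)) s

NowhereDense : Family → Set₁
NowhereDense N = ∀ (s : List Bool) → Σ (List Bool) λ t → ∀ X → Extends X (s ++ t) → ¬ N X

Meager : Family → Set₂
Meager M = Σ (ℕ → Family) λ N → (∀ k → NowhereDense (N k)) × (∀ X → M X → Σ ℕ λ k → N k X)

CompletelyMeager : Family → Set₂
CompletelyMeager F = ∀ (X : Subset) → (F ⁺) X → Meager (Generated (Adjoin F X))

BigUnion : (ℕ → List ℕ) → Subset
BigUnion X m = Σ ℕ λ i → m ∈ X i

Condition2 : Family → Set₁
Condition2 F =
  ∀ (X : ℕ → List ℕ) → (F ⁺) (BigUnion X) →
  Σ (ℕ → ℕ) λ n → (∀ k → n k < n (suc k)) ×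
    (∀ (Y : Subset) → F Y →
      Σ ℕ λ K → ∀ k → K ≤ k →
        Σ ℕ λ i → (n k ≤ i) × (i < n (suc k)) × Σ ℕ λ m → (m ∈ X i) × Y m)

-- (2) ⇒ (1): given X ∈ F⁺, apply (2) to the singletons {i}, i ∈ X. Every member of the filter
-- generated by F ∪ {X} contains Y ∩ X for some Y ∈ F, so it meets all but finitely many of the
-- intervals [n k, n (k+1)); and for fixed K the sets meeting every interval beyond K form a
-- nowhere dense set, since any string can be padded with zeros past a whole interval.
-- (1) ⇒ (2): let U = ⋃ X i and cover the filter generated by F ∪ {U} by nowhere dense sets N j.
-- Choose consecutive blocks [start k, end k) with a string stamp k on each, such that no set
-- agreeing with any string of length start k followed by stamp k lies in N 0 ∪ … ∪ N k; this is
-- possible because there are only finitely many such strings. For Y ∈ F, add to Y ∩ U the stamp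
-- of every block whose interval Y misses: the result lies in the generated filter, hence in some
-- N j, so Y misses no interval k ≥ j.

module Submission where

open import Defs
open import Level using (Lift; lift; lower) renaming (suc to lsuc; zero to lzero)
open import Axiom.ExcludedMiddle using (ExcludedMiddle)
open import Function.Bundles using (_⇔_; mk⇔; Equivalence)
open import Data.Nat using (ℕ; zero; suc; _≤_; _<_; _+_; _∸_; z≤n; s≤s)
open import Data.Nat.Properties
open import Data.Bool using (Bool; T; true; false)
open import Data.List using (List; []; _∷_; _++_; length; replicate; map; concat; applyUpTo)
open import Data.List.Properties using (++-assoc)
open import Data.List.Membership.Propositional using (_∈_)
open import Data.List.Membership.Propositional.Properties using (∈-++⁺ˡ; ∈-++⁺ʳ; ∈-map⁺; ∈-concat⁺′; ∈-applyUpTo⁺)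
open import Data.List.Relation.Unary.All as All using (All; []; _∷_)
open import Data.List.Relation.Unary.Any using (here; there)
open import Data.List.Extrema.Nat using (max; xs≤max)
open import Data.Product using (Σ; _×_; _,_; proj₁; proj₂)
open import Data.Sum using (_⊎_; inj₁; inj₂)
open import Data.Unit using (⊤; tt)
open import Data.Empty using (⊥-elim)
open import Relation.Nullary using (¬_; yes; no; contradiction)
open import Relation.Nullary.Decidable using (isYes; map′; toWitness; fromWitness; decidable-stable)
open import Relation.Binary.PropositionalEquality using (_≡_; refl; sym; cong; subst)
open import Relation.Binary.Definitions using (tri<; tri≈; tri>)

Extends-++⁻ˡ : ∀ {Z} s t → Extends Z (s ++ t) → Extends Z s
Extends-++⁻ˡ []      t _       = tt
Extends-++⁻ˡ (_ ∷ s) t (b , e) = b , Extends-++⁻ˡ s t e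

Extends-++⁻ʳ : ∀ {Z} s t → Extends Z (s ++ t) → Extends (λ r → Z (length s + r)) t
Extends-++⁻ʳ []      t e       = e
Extends-++⁻ʳ (_ ∷ s) t (_ , e) = Extends-++⁻ʳ s t e

Extends-replicate-false : ∀ {Z} l → Extends Z (replicate l false) → ∀ {r} → r < l → ¬ Z r
Extends-replicate-false (suc l) (b , _) {zero}  _         z = Equivalence.to b z
Extends-replicate-false (suc l) (_ , e) {suc r} (s≤s r<l) z = Extends-replicate-false l e r<l z

bitAt : List Bool → ℕ → Bool
bitAt []      _       = false
bitAt (b ∷ _) zero    = b
bitAt (_ ∷ t) (suc r) = bitAt t r

bitAt-true⇒< : ∀ t {r} → T (bitAt t r) → r < length t
bitAt-true⇒< (_ ∷ t) {zero}  _ = s≤s z≤n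
bitAt-true⇒< (_ ∷ t) {suc r} b = s≤s (bitAt-true⇒< t b)

bitAt⇒Extends : ∀ {Z} t → (∀ r → r < length t → Z r ⇔ T (bitAt t r)) → Extends Z t
bitAt⇒Extends []      _ = tt
bitAt⇒Extends (_ ∷ t) f = f zero (s≤s z≤n) , bitAt⇒Extends t (λ r r<l → f (suc r) (s≤s r<l))

allStrings : ℕ → List (List Bool)
allStrings zero    = [] ∷ []
allStrings (suc p) = map (true ∷_) (allStrings p) ++ map (false ∷_) (allStrings p)

∈-allStrings : ∀ s → s ∈ allStrings (length s)
∈-allStrings []          = here refl
∈-allStrings (true ∷ s)  = ∈-++⁺ˡ (∈-map⁺ (true ∷_) (∈-allStrings s))
∈-allStrings (false ∷ s) = ∈-++⁺ʳ _ (∈-map⁺ (false ∷_) (∈-allStrings s))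

Escapes : Family → List Bool → List Bool → Set₁
Escapes M s t = ∀ Z → Extends Z (s ++ t) → ¬ M Z

Escapes-++ : ∀ {M} s t u → Escapes M s t → Escapes M s (t ++ u)
Escapes-++ s t u esc Z e =
  esc Z (Extends-++⁻ˡ (s ++ t) u (subst (Extends Z) (sym (++-assoc s t u)) e))

Escapes-assoc : ∀ {M} s t u → Escapes M (s ++ t) u → Escapes M s (t ++ u)
Escapes-assoc s t u esc Z e = esc Z (subst (Extends Z) (sym (++-assoc s t u)) e)

NowhereDense⇒escapeAll : ∀ {M} → NowhereDense M → (S : List (List Bool)) →
                         Σ (List Bool) λ t → All (λ s → Escapes M s t) S
NowhereDense⇒escapeAll nd []      = [] , []
NowhereDense⇒escapeAll nd (s ∷ S) with NowhereDense⇒escapeAll nd S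
... | t , escS with nd (s ++ t)
...   | u , escs = t ++ u , Escapes-assoc s t u escs ∷ All.map (Escapes-++ _ t u) escS

NowhereDense⇒uniformEscape : ∀ {M} → NowhereDense M → ∀ p →
                             Σ (List Bool) λ t → ∀ s → length s ≡ p → Escapes M s t
NowhereDense⇒uniformEscape nd p with NowhereDense⇒escapeAll nd (allStrings p)
... | t , esc = t , λ { s refl → All.lookup esc (∈-allStrings s) }

_∪_ : Family → Family → Family
(M ∪ M′) Z = M Z ⊎ M′ Z

NowhereDense-∪ : ∀ {M M′} → NowhereDense M → NowhereDense M′ → NowhereDense (M ∪ M′)
NowhereDense-∪ nd nd′ s with nd s
... | t , esc with nd′ (s ++ t)
...   | u , esc′ = t ++ u , λ where
  Z e (inj₁ m)  → Escapes-++ s t u esc Z e m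
  Z e (inj₂ m′) → Escapes-assoc s t u esc′ Z e m′

⋃≤ : (ℕ → Family) → ℕ → Family
⋃≤ N zero    = N zero
⋃≤ N (suc k) = ⋃≤ N k ∪ N (suc k)

⋃≤⁺ : ∀ N {j k Z} → j ≤ k → N j Z → ⋃≤ N k Z
⋃≤⁺ N {k = zero}  z≤n n = n
⋃≤⁺ N {k = suc k} j≤k n with m≤n⇒m<n∨m≡n j≤k
... | inj₁ (s≤s j≤k′) = inj₁ (⋃≤⁺ N j≤k′ n)
... | inj₂ refl       = inj₂ n

NowhereDense-⋃≤ : ∀ {N} → (∀ j → NowhereDense (N j)) → ∀ k → NowhereDense (⋃≤ N k)
NowhereDense-⋃≤ nd zero    = nd zero
NowhereDense-⋃≤ nd (suc k) = NowhereDense-∪ (NowhereDense-⋃≤ nd k) (nd (suc k))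

opaque
  upperBound : List ℕ → ℕ
  upperBound xs = suc (max 0 xs)

  ∈⇒<upperBound : ∀ {m xs} → m ∈ xs → m < upperBound xs
  ∈⇒<upperBound {xs = xs} m∈xs = s≤s (All.lookup (xs≤max 0 xs) m∈xs)

strictlyIncreasing⇒id≤ : ∀ {n : ℕ → ℕ} → (∀ k → n k < n (suc k)) → ∀ k → k ≤ n k
strictlyIncreasing⇒id≤ inc zero    = z≤n
strictlyIncreasing⇒id≤ inc (suc k) = ≤-trans (s≤s (strictlyIncreasing⇒id≤ inc k)) (inc k)

module _ {a b : ℕ → ℕ} (a≤b : ∀ k → a k ≤ b k) (b≤a : ∀ k → b k ≤ a (suc k)) where

  intervals-ordered : ∀ {i j} → i < j → b i ≤ a j
  intervals-ordered {i} {suc j} (s≤s i≤j) with m≤n⇒m<n∨m≡n i≤j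
  ... | inj₁ i<j = ≤-trans (intervals-ordered i<j) (≤-trans (a≤b j) (b≤a j))
  ... | inj₂ refl = b≤a i

  intervals-disjoint : ∀ {i j m} → a i ≤ m → m < b i → a j ≤ m → m < b j → i ≡ j
  intervals-disjoint {i} {j} aᵢ≤m m<bᵢ aⱼ≤m m<bⱼ with <-cmp i j
  ... | tri< i<j _ _ = contradiction (≤-trans (intervals-ordered i<j) aⱼ≤m) (<⇒≱ m<bᵢ)
  ... | tri≈ _ i≡j _ = i≡j
  ... | tri> _ _ j<i = contradiction (≤-trans (intervals-ordered j<i) aᵢ≤m) (<⇒≱ m<bⱼ)

Placed : ℕ → List Bool → Subset
Placed p t m = Σ ℕ λ r → m ≡ p + r × T (bitAt t r)

MeetsEveryIntervalFrom : (ℕ → ℕ) → ℕ → Family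
MeetsEveryIntervalFrom n K Z =
  Lift (lsuc lzero) (∀ k → K ≤ k → Σ ℕ λ m → n k ≤ m × m < n (suc k) × Z m)

MeetsEveryIntervalFrom-nowhereDense : ∀ {n} → (∀ k → n k < n (suc k)) →
                                      ∀ K → NowhereDense (MeetsEveryIntervalFrom n K)
MeetsEveryIntervalFrom-nowhereDense {n} inc K s =
  zeros , λ Z e (lift hit) → misses Z e (hit k (m≤m+n K (length s)))
  where
  k = K + length s
  zeros = replicate (n (suc k) ∸ length s) false

  |s|≤nₖ : length s ≤ n k
  |s|≤nₖ = ≤-trans (m≤n+m (length s) K) (strictlyIncreasing⇒id≤ inc k)

  misses : ∀ Z → Extends Z (s ++ zeros) → ¬ (Σ ℕ λ m → n k ≤ m × m < n (suc k) × Z m)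
  misses Z e (m , nₖ≤m , m<nₖ₊₁ , z) =
    Extends-replicate-false _ (Extends-++⁻ʳ s zeros e) (∸-monoˡ-< m<nₖ₊₁ |s|≤m)
      (subst Z (sym (m+[n∸m]≡n |s|≤m)) z)
    where |s|≤m = ≤-trans |s|≤nₖ nₖ≤m

Generated-Adjoin⇒⊇∩ : ∀ {F X Z} → IsFilter F → Generated (Adjoin F X) Z →
                      Σ Subset λ Y → F Y × (Y ∩ X) ⊆ Z
Generated-Adjoin⇒⊇∩ isF (base (inj₁ FY)) = _ , FY , λ _ → proj₁
Generated-Adjoin⇒⊇∩ isF (base (inj₂ refl)) =
  _ , IsFilter.cofinite isF (λ _ → ⊤) (0 , λ _ _ → tt) , λ _ → proj₂
Generated-Adjoin⇒⊇∩ isF (superset g Z⊆Z′) with Generated-Adjoin⇒⊇∩ isF g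
... | Y , FY , Y∩X⊆Z = Y , FY , λ m p → Z⊆Z′ m (Y∩X⊆Z m p)
Generated-Adjoin⇒⊇∩ isF (intersection g g′)
  with Generated-Adjoin⇒⊇∩ isF g | Generated-Adjoin⇒⊇∩ isF g′
... | Y , FY , Y∩X⊆Z | Y′ , FY′ , Y′∩X⊆Z′ =
  Y ∩ Y′ , IsFilter.intersection isF Y Y′ FY FY′ ,
  λ { m ((y , y′) , x) → Y∩X⊆Z m (y , x) , Y′∩X⊆Z′ m (y′ , x) }
Generated-Adjoin⇒⊇∩ isF (cofinite cof) = _ , IsFilter.cofinite isF _ cof , λ _ → proj₁

module Classical (em : ExcludedMiddle lzero) where

  bits : Subset → ℕ → List Bool
  bits Z zero    = []
  bits Z (suc p) = isYes (em {Z zero}) ∷ bits (λ r → Z (suc r)) p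

  bits-length : ∀ Z p → length (bits Z p) ≡ p
  bits-length Z zero    = refl
  bits-length Z (suc p) = cong suc (bits-length (λ r → Z (suc r)) p)

  Extends-bits-++ : ∀ {Z} p t → Extends (λ r → Z (p + r)) t → Extends Z (bits Z p ++ t)
  Extends-bits-++ zero    t e = e
  Extends-bits-++ (suc p) t e = mk⇔ fromWitness toWitness , Extends-bits-++ p t e

  singletons : Subset → ℕ → List ℕ
  singletons X i with em {X i}
  ... | yes _ = i ∷ []
  ... | no _  = []

  ∈-singletons⁺ : ∀ {X m} → X m → m ∈ singletons X m
  ∈-singletons⁺ {X} {m} x with em {X m}
  ... | yes _ = here refl
  ... | no ¬x = ⊥-elim (¬x x)

  ∈-singletons⁻ : ∀ {X i m} → m ∈ singletons X i → m ≡ i × X m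
  ∈-singletons⁻ {X} {i} m∈ with em {X i}
  ∈-singletons⁻ (here refl) | yes x = refl , x

  ⋃singletons-⁺ : ∀ {F X} → IsFilter F → (F ⁺) X → (F ⁺) (BigUnion (singletons X))
  ⋃singletons-⁺ isF X⁺ F∁⋃ =
    X⁺ (IsFilter.superset isF _ _ F∁⋃ λ m m∉⋃ x → m∉⋃ (m , ∈-singletons⁺ x))

  Condition2⇒CompletelyMeager : ∀ {F} → IsFilter F → Condition2 F → CompletelyMeager F
  Condition2⇒CompletelyMeager {F} isF c2 X X⁺ with c2 (singletons X) (⋃singletons-⁺ isF X⁺)
  ... | n , n-increasing , meets =
    MeetsEveryIntervalFrom n , MeetsEveryIntervalFrom-nowhereDense n-increasing , covered
    where
    covered : ∀ Z → Generated (Adjoin F X) Z → Σ ℕ λ K → MeetsEveryIntervalFrom n K Z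
    covered Z g with Generated-Adjoin⇒⊇∩ isF g
    ... | Y , FY , Y∩X⊆Z with meets Y FY
    ... | K , hit = K , lift λ k K≤k → point (hit k K≤k)
      where
      point : ∀ {k} → (Σ ℕ λ i → n k ≤ i × i < n (suc k) × Σ ℕ λ m → m ∈ singletons X i × Y m) →
              Σ ℕ λ m → n k ≤ m × m < n (suc k) × Z m
      point (i , nₖ≤i , i<nₖ₊₁ , m , m∈ , y) with ∈-singletons⁻ m∈
      ... | refl , x = m , nₖ≤i , i<nₖ₊₁ , Y∩X⊆Z m (y , x)

  module Blocks {F} (cm : CompletelyMeager F) (X : ℕ → List ℕ) (X⁺ : (F ⁺) (BigUnion X)) where

    U : Subset
    U = BigUnion X

    N : ℕ → Family
    N = proj₁ (cm U X⁺)

    N-nowhereDense : ∀ j → NowhereDense (N j)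
    N-nowhereDense = proj₁ (proj₂ (cm U X⁺))

    N-covers : ∀ Z → Generated (Adjoin F U) Z → Σ ℕ λ j → N j Z
    N-covers = proj₂ (proj₂ (cm U X⁺))

    pieceIndex : ℕ → ℕ
    pieceIndex m with em {U m}
    ... | yes (i , _) = i
    ... | no _        = 0

    ∈-pieceIndex : ∀ {m} → U m → m ∈ X (pieceIndex m)
    ∈-pieceIndex {m} u with em {U m}
    ... | yes (_ , m∈Xᵢ) = m∈Xᵢ
    ... | no ¬u          = ⊥-elim (¬u u)

    uniformEscape : ∀ k p → Σ (List Bool) λ t → ∀ s → length s ≡ p → Escapes (⋃≤ N k) s t
    uniformEscape k = NowhereDense⇒uniformEscape (NowhereDense-⋃≤ N-nowhereDense k)

    n start end : ℕ → ℕ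
    stamp : ℕ → List Bool

    -- Every point of U below end k lies in some X i with i < n (k+1), while start (k+1) exceeds
    -- every point of the X i with i < n (k+1); so a point of U in block k lies in some X i with
    -- n k ≤ i < n (k+1).
    stamp k = proj₁ (uniformEscape k (start k))
    end k   = start k + length (stamp k)

    n zero    = 0
    n (suc k) = upperBound (n k ∷ applyUpTo pieceIndex (end k))

    start zero    = 0
    start (suc k) = upperBound (end k ∷ concat (applyUpTo X (n (suc k))))

    stamp-escapes : ∀ k s → length s ≡ start k → Escapes (⋃≤ N k) s (stamp k)
    stamp-escapes k = proj₂ (uniformEscape k (start k))

    n-increasing : ∀ k → n k < n (suc k)
    n-increasing k = ∈⇒<upperBound (here refl)

    start≤end : ∀ k → start k ≤ end k
    start≤end k = m≤m+n (start k) (length (stamp k))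

    end≤start : ∀ k → end k ≤ start (suc k)
    end≤start k = <⇒≤ (∈⇒<upperBound (here refl))

    X-below-start : ∀ {k i m} → i < n k → m ∈ X i → m < start k
    X-below-start {suc k} i<nₖ m∈Xᵢ =
      ∈⇒<upperBound (there (∈-concat⁺′ m∈Xᵢ (∈-applyUpTo⁺ X i<nₖ)))

    pieceIndex-bounded : ∀ {k m} → m < end k → pieceIndex m < n (suc k)
    pieceIndex-bounded m<end = ∈⇒<upperBound (there (∈-applyUpTo⁺ pieceIndex m<end))

    Meets : Subset → ℕ → Set
    Meets Y k = Σ ℕ λ i → n k ≤ i × i < n (suc k) × Σ ℕ λ m → m ∈ X i × Y m

    inBlock⇒Meets : ∀ {Y k m} → start k ≤ m → m < end k → U m → Y m → Meets Y k
    inBlock⇒Meets {k = k} {m} start≤m m<end u y =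
      pieceIndex m , nₖ≤i , pieceIndex-bounded {k} m<end , m , ∈-pieceIndex u , y
      where
      nₖ≤i = ≮⇒≥ λ i<nₖ → <⇒≱ (X-below-start {k} i<nₖ (∈-pieceIndex u)) start≤m

    patched : Subset → Subset
    patched Y m = (Y m × U m) ⊎ Σ ℕ λ k → ¬ Meets Y k × Placed (start k) (stamp k) m

    patched-generated : ∀ {Y} → F Y → Generated (Adjoin F U) (patched Y)
    patched-generated FY = superset (intersection (base (inj₁ FY)) (base (inj₂ refl))) (λ _ → inj₁)

    patched-on-block : ∀ {Y k} → ¬ Meets Y k →
                       ∀ r → r < length (stamp k) → patched Y (start k + r) ⇔ T (bitAt (stamp k) r)
    patched-on-block {Y} {k} ¬meets r r<l = mk⇔ to λ b → inj₂ (k , ¬meets , r , refl , b)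
      where
      to : patched Y (start k + r) → T (bitAt (stamp k) r)
      to (inj₁ (y , u)) =
        ⊥-elim (¬meets (inBlock⇒Meets {k = k} (m≤m+n _ r) (+-monoʳ-< (start k) r<l) u y))
      to (inj₂ (k′ , _ , r′ , eq , b))
        with intervals-disjoint start≤end end≤start {k′} {k}
               (subst (start k′ ≤_) (sym eq) (m≤m+n _ r′))
               (subst (_< end k′) (sym eq) (+-monoʳ-< (start k′) (bitAt-true⇒< (stamp k′) b)))
               (m≤m+n (start k) r) (+-monoʳ-< (start k) r<l)
      ... | refl = subst (λ r″ → T (bitAt (stamp k) r″)) (+-cancelˡ-≡ (start k) r′ r (sym eq)) b

    patched-extends : ∀ {Y k} → ¬ Meets Y k →
                      Extends (patched Y) (bits (patched Y) (start k) ++ stamp k)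
    patched-extends {k = k} ¬meets =
      Extends-bits-++ (start k) (stamp k) (bitAt⇒Extends (stamp k) (patched-on-block {k = k} ¬meets))

    meetsEventually : ∀ {Y} → F Y → Σ ℕ λ K → ∀ k → K ≤ k → Meets Y k
    meetsEventually {Y} FY with N-covers (patched Y) (patched-generated FY)
    ... | j , Nⱼ = j , λ k j≤k → decidable-stable em λ ¬meets →
      stamp-escapes k (bits (patched Y) (start k)) (bits-length (patched Y) (start k)) (patched Y)
        (patched-extends {k = k} ¬meets)
        (⋃≤⁺ N j≤k Nⱼ)

  CompletelyMeager⇒Condition2 : ∀ {F} → CompletelyMeager F → Condition2 F
  CompletelyMeager⇒Condition2 cm X X⁺ = n , n-increasing , λ Y → meetsEventually
    where open Blocks cm X X⁺

lemma2p3 : ExcludedMiddle (lsuc (lsuc lzero)) → (F : Family) → IsFilter F →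
    CompletelyMeager F ⇔ Condition2 F
lemma2p3 em F isF = mk⇔ CompletelyMeager⇒Condition2 (Condition2⇒CompletelyMeager isF)
  where open Classical (λ {P} → map′ lower lift (em {Lift _ P}))
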